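{- Let $\mathbf{P}\colon\mathsf{C}^{\mathrm{op}}\to\mathsf{BA}$ be a Boolean doctrine, $F=(F_X)_{X\in\mathsf{C}}$ a universal filter, $I=(I_X)_{X\in\mathsf{C}}$ a universal ideal for $\mathbf{P}$, $Y\in\mathsf{C}$ and $\alpha\in\mathbf{P}(Y)$. (1) The universal filter generated by $F$ and $\alpha$ intersects $I$ (in some component) if and only if there are $X\in\mathsf{C}$, $n\in\mathbb{N}$, morphisms $f_1,\dots,f_n\colon X\to Y$ and $\beta\in F_X$ with $\beta\land\bigwedge_{i=1}^n\mathbf{P}(f_i)(\alpha)\in I_X$. (2) The universal ideal generated by $I$ and $\alpha$ intersects $F$ (in some component) if and only if there is $X\in\mathsf{C}$ with $I_X\cap F_X\neq\varnothing$, or there are $Z\in\mathsf{C}$ and $\gamma\in I_Z$ with $\mathbf{P}(\mathrm{pr}_1)(\alpha)\lor\mathbf{P}(\mathrm{pr}_2)(\gamma)\in F_{Y\times Z}$.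
   Context: Categories have finite products; $\mathbf{t}$ terminal, $\mathrm{pr}_i$ projections. A Boolean doctrine is a functor $\mathbf{P}\colon\mathsf{C}^{\mathrm{op}}\to\mathsf{BA}$. A universal filter for $\mathbf{P}$ is a family $(F_X)_{X\in\mathsf{C}}$, $F_X\subseteq\mathbf{P}(X)$, with $\mathbf{P}(f)(\alpha)\in F_X$ for all $f\colon X\to Y$ and $\alpha\in F_Y$, and each $F_X$ a filter. A universal ideal is a family $(I_X)$, $I_X\subseteq\mathbf{P}(X)$, with: (i) for $m\in\mathbb{N}$, $f_1,\dots,f_m\colon X\to Y$, $\alpha\in\mathbf{P}(Y)$, if $\bigwedge_{j=1}^m\mathbf{P}(f_j)(\alpha)\in I_X$ then $\alpha\in I_Y$; (ii) each $I_X$ downward closed; (iii) $\alpha_1\in I_{X_1}$, $\alpha_2\in I_{X_2}$ imply $\mathbf{P}(\mathrm{pr}_1)(\alpha_1)\lor\mathbf{P}(\mathrm{pr}_2)(\alpha_2)\in I_{X_1\times X_2}$; (iv) $\bot_{\mathbf{P}(\mathbf{t})}\in I_{\mathbf{t}}$. The universal filter (resp. ideal) generated by a family is the smallest universal filter (resp. ideal) componentwise containing it. -}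

module Defs where

open import Level using (Level; _⊔_) renaming (suc to lsuc)
open import Data.Nat using (ℕ; zero; suc)
open import Data.Fin using (Fin; zero; suc)
open import Data.Product using (Σ; _×_; _,_; ∃-syntax)
open import Relation.Binary.PropositionalEquality using (_≡_)
open import Algebra.Lattice.Bundles using (BooleanAlgebra)

record Category (o h : Level) : Set (lsuc (o ⊔ h)) where
  infixr 9 _∘_
  field
    Obj  : Set o
    Hom  : Obj → Obj → Set h
    id   : {X : Obj} → Hom X X
    _∘_  : {X Y Z : Obj} → Hom Y Z → Hom X Y → Hom X Z
    identityˡ : {X Y : Obj} (f : Hom X Y) → id ∘ f ≡ f
    identityʳ : {X Y : Obj} (f : Hom X Y) → f ∘ id ≡ f
    assoc : {W X Y Z : Obj} (f : Hom W X) (g : Hom X Y) (k : Hom Y Z) →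
            (k ∘ g) ∘ f ≡ k ∘ (g ∘ f)

record FinProducts {o h : Level} (C : Category o h) : Set (o ⊔ h) where
  open Category C
  field
    t        : Obj
    !        : {X : Obj} → Hom X t
    !-unique : {X : Obj} (f : Hom X t) → f ≡ !
    _×ₒ_     : Obj → Obj → Obj
    pr₁      : {X₁ X₂ : Obj} → Hom (X₁ ×ₒ X₂) X₁
    pr₂      : {X₁ X₂ : Obj} → Hom (X₁ ×ₒ X₂) X₂
    ⟨_,_⟩    : {Z X₁ X₂ : Obj} → Hom Z X₁ → Hom Z X₂ → Hom Z (X₁ ×ₒ X₂)
    pr₁-β    : {Z X₁ X₂ : Obj} (f : Hom Z X₁) (g : Hom Z X₂) → pr₁ ∘ ⟨ f , g ⟩ ≡ f
    pr₂-β    : {Z X₁ X₂ : Obj} (f : Hom Z X₁) (g : Hom Z X₂) → pr₂ ∘ ⟨ f , g ⟩ ≡ g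
    ⟨⟩-unique : {Z X₁ X₂ : Obj} (k : Hom Z (X₁ ×ₒ X₂)) → ⟨ pr₁ ∘ k , pr₂ ∘ k ⟩ ≡ k

record IsBAHom {c₁ ℓ₁ c₂ ℓ₂ : Level} (A : BooleanAlgebra c₁ ℓ₁) (B : BooleanAlgebra c₂ ℓ₂)
               (φ : BooleanAlgebra.Carrier A → BooleanAlgebra.Carrier B)
               : Set (c₁ ⊔ ℓ₁ ⊔ ℓ₂) where
  private
    module A = BooleanAlgebra A
    module B = BooleanAlgebra B
  field
    cong  : {x y : A.Carrier} → x A.≈ y → φ x B.≈ φ y
    hom-∧ : (x y : A.Carrier) → φ (x A.∧ y) B.≈ (φ x B.∧ φ y)
    hom-∨ : (x y : A.Carrier) → φ (x A.∨ y) B.≈ (φ x B.∨ φ y)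
    hom-¬ : (x : A.Carrier) → φ (A.¬ x) B.≈ B.¬ (φ x)
    hom-⊤ : φ A.⊤ B.≈ B.⊤
    hom-⊥ : φ A.⊥ B.≈ B.⊥

record BooleanDoctrine {o h : Level} (C : Category o h) (c ℓ : Level)
       : Set (o ⊔ h ⊔ lsuc (c ⊔ ℓ)) where
  open Category C
  field
    P₀ : Obj → BooleanAlgebra c ℓ
  open BooleanAlgebra
  field
    P₁ : {X Y : Obj} → Hom X Y → Carrier (P₀ Y) → Carrier (P₀ X)
    P₁-hom : {X Y : Obj} (f : Hom X Y) → IsBAHom (P₀ Y) (P₀ X) (P₁ f)
    P₁-id  : {X : Obj} (a : Carrier (P₀ X)) → _≈_ (P₀ X) (P₁ id a) a
    P₁-∘   : {X Y Z : Obj} (f : Hom X Y) (g : Hom Y Z) (a : Carrier (P₀ Z)) →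
             _≈_ (P₀ X) (P₁ (g ∘ f) a) (P₁ f (P₁ g a))

module _ {c ℓ : Level} (B : BooleanAlgebra c ℓ) where
  open BooleanAlgebra B

  _≤ᴮ_ : Carrier → Carrier → Set ℓ
  x ≤ᴮ y = (x ∧ y) ≈ x

  bigMeet : (n : ℕ) → (Fin n → Carrier) → Carrier
  bigMeet zero    a = ⊤
  bigMeet (suc n) a = a zero ∧ bigMeet n (λ i → a (suc i))

  record IsFilter {p : Level} (S : Carrier → Set p) : Set (c ⊔ ℓ ⊔ p) where
    field
      ⊤-mem  : S ⊤
      ∧-mem  : {x y : Carrier} → S x → S y → S (x ∧ y)
      up-mem : {x y : Carrier} → x ≤ᴮ y → S x → S y

  IsDownClosed : {p : Level} (S : Carrier → Set p) → Set (c ⊔ ℓ ⊔ p)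
  IsDownClosed S = {x y : Carrier} → x ≤ᴮ y → S y → S x

module _ {o h c ℓ : Level} {C : Category o h} (Pr : FinProducts C)
         (D : BooleanDoctrine C c ℓ) where
  open Category C
  open FinProducts Pr
  open BooleanDoctrine D
  open BooleanAlgebra using (Carrier)

  Family : (p : Level) → Set (o ⊔ c ⊔ lsuc p)
  Family p = (X : Obj) → Carrier (P₀ X) → Set p

  _⊆ᶠ_ : {p q : Level} → Family p → Family q → Set (o ⊔ c ⊔ p ⊔ q)
  S ⊆ᶠ T = (X : Obj) (a : Carrier (P₀ X)) → S X a → T X a

  record IsUniversalFilter {p : Level} (F : Family p) : Set (o ⊔ h ⊔ c ⊔ ℓ ⊔ p) where
    field
      stable : {X Y : Obj} (f : Hom X Y) (a : Carrier (P₀ Y)) → F Y a → F X (P₁ f a)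
      filter : (X : Obj) → IsFilter (P₀ X) (F X)

  record IsUniversalIdeal {p : Level} (I : Family p) : Set (o ⊔ h ⊔ c ⊔ ℓ ⊔ p) where
    field
      reflect : {X Y : Obj} (m : ℕ) (f : Fin m → Hom X Y) (a : Carrier (P₀ Y)) →
                I X (bigMeet (P₀ X) m (λ j → P₁ (f j) a)) → I Y a
      down : (X : Obj) → IsDownClosed (P₀ X) (I X)
      prod : {X₁ X₂ : Obj} (a₁ : Carrier (P₀ X₁)) (a₂ : Carrier (P₀ X₂)) →
             I X₁ a₁ → I X₂ a₂ →
             I (X₁ ×ₒ X₂) (BooleanAlgebra._∨_ (P₀ (X₁ ×ₒ X₂))
                              (P₁ (pr₁ {X₁} {X₂}) a₁) (P₁ (pr₂ {X₁} {X₂}) a₂))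
      bot : I t (BooleanAlgebra.⊥ (P₀ t))

  data Adjoin {p : Level} (S : Family p) (Y : Obj) (a : Carrier (P₀ Y))
              : (X : Obj) → Carrier (P₀ X) → Set (o ⊔ c ⊔ p) where
    old : {X : Obj} {b : Carrier (P₀ X)} → S X b → Adjoin S Y a X b
    new : Adjoin S Y a Y a

  GenFilter : {q : Level} (p : Level) → Family q → Family (o ⊔ h ⊔ c ⊔ ℓ ⊔ q ⊔ lsuc p)
  GenFilter p S X b = (G : Family p) → IsUniversalFilter G → S ⊆ᶠ G → G X b

  GenIdeal : {q : Level} (p : Level) → Family q → Family (o ⊔ h ⊔ c ⊔ ℓ ⊔ q ⊔ lsuc p)
  GenIdeal p S X b = (G : Family p) → IsUniversalIdeal G → S ⊆ᶠ G → G X b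

  Meets : {p q : Level} → Family p → Family q → Set (o ⊔ c ⊔ p ⊔ q)
  Meets S T = Σ Obj λ X → Σ (Carrier (P₀ X)) λ b → S X b × T X b

{-# OPTIONS --safe #-}
-- The filter generated by F and α has an explicit description: b lies in it at X iff
-- β ∧ ⋀ᵢ P(fᵢ)(α) ≤ b for some β ∈ F_X and finitely many fᵢ : X → Y (Extension F α).
-- Part (1) then follows because I is downward closed.
-- For part (2), JoinIdeal F I α collects those b ∈ P(X) for which F extended by b
-- contains P(pr₁)(α) ∨ P(pr₂)(γ) for some γ ∈ I. It is a universal ideal containing I
-- and α; the only substantial axiom is (iii), obtained by pairing the two witnesses and
-- distributing the join over the two finite meets. An element of F adds nothing to F,
-- so any b ∈ F in JoinIdeal F I α yields the second alternative directly.
module Submission where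

open import Defs
open import Level using (Level; _⊔_)
open import Data.Nat using (ℕ)
open import Data.Fin using (Fin)
open import Data.Product using (Σ; _×_)
import Data.Sum
open import Function.Bundles using (_⇔_)
open import Algebra.Lattice.Bundles using (BooleanAlgebra)

open import Data.Nat using (zero; suc; _+_)
open import Data.Fin using (zero; suc; splitAt)
open import Data.Product using (_,_)
open import Data.Sum.Properties using ([,]-map; [,]-∘)
open import Data.Vec.Functional using (_++_; _∷_; tail)
open import Function.Bundles using (mk⇔)
open import Relation.Binary.PropositionalEquality using (cong₂)
open import Relation.Binary.Lattice.Bundles using (Lattice)
import Algebra.Lattice.Properties.Lattice as LatticeProperties
import Algebra.Lattice.Properties.BooleanAlgebra as BooleanAlgebraProperties
import Relation.Binary.Lattice.Properties.MeetSemilattice as MeetSemilatticeProperties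
import Relation.Binary.Lattice.Properties.JoinSemilattice as JoinSemilatticeProperties
import Relation.Binary.Reasoning.PartialOrder as PartialOrderReasoning
import Relation.Binary.Reasoning.Setoid as SetoidReasoning

module BooleanAlgebraOrder {c ℓ : Level} (B : BooleanAlgebra c ℓ) where
  open BooleanAlgebra B
  open BooleanAlgebraProperties B using (∧-zeroˡ)

  orderTheoreticLattice : Lattice c ℓ ℓ
  orderTheoreticLattice = LatticeProperties.∨-∧-orderTheoreticLattice lattice

  open Lattice orderTheoreticLattice public
    using (_≤_; poset; x≤x∨y; y≤x∨y; ∨-least; x∧y≤x; x∧y≤y; ∧-greatest)
    renaming (refl to ≤-refl; reflexive to ≤-reflexive; trans to ≤-trans)
  open MeetSemilatticeProperties (Lattice.meetSemilattice orderTheoreticLattice) public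
    using (∧-monotonic)
  open JoinSemilatticeProperties (Lattice.joinSemilattice orderTheoreticLattice) public
    using (∨-monotonic)
  module ≤-Reasoning = PartialOrderReasoning poset

  ⊥≤x : ∀ {x} → ⊥ ≤ x
  ⊥≤x {x} = sym (∧-zeroˡ x)

  -- Defs orders by x ∧ y ≈ x, the library's natural order by x ≈ x ∧ y.
  ≤⇒≤ᴮ : ∀ {x y} → x ≤ y → _≤ᴮ_ B x y
  ≤⇒≤ᴮ = sym

  ≤ᴮ⇒≤ : ∀ {x y} → _≤ᴮ_ B x y → x ≤ y
  ≤ᴮ⇒≤ = sym

module FiniteMeets {c ℓ : Level} (B : BooleanAlgebra c ℓ) where
  open BooleanAlgebra B
  open BooleanAlgebraProperties B using (∧-identityˡ)
  open SetoidReasoning setoid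

  bigMeet-cong : ∀ n {as bs : Fin n → Carrier} → (∀ i → as i ≈ bs i) →
                 bigMeet B n as ≈ bigMeet B n bs
  bigMeet-cong zero    eq = refl
  bigMeet-cong (suc n) eq = ∧-cong (eq zero) (bigMeet-cong n (λ i → eq (suc i)))

  bigMeet-++ : ∀ m {n} (as : Fin m → Carrier) (bs : Fin n → Carrier) →
               bigMeet B (m + n) (as ++ bs) ≈ bigMeet B m as ∧ bigMeet B n bs
  bigMeet-++ zero    as bs = sym (∧-identityˡ _)
  bigMeet-++ (suc m) {n} as bs = begin
    as zero ∧ bigMeet B (m + n) (tail (as ++ bs))
      ≈⟨ ∧-congˡ (bigMeet-cong (m + n) (λ i → reflexive ([,]-map (splitAt m i)))) ⟩
    as zero ∧ bigMeet B (m + n) (tail as ++ bs)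
      ≈⟨ ∧-congˡ (bigMeet-++ m (tail as) bs) ⟩
    as zero ∧ (bigMeet B m (tail as) ∧ bigMeet B n bs)
      ≈⟨ ∧-assoc _ _ _ ⟨
    (as zero ∧ bigMeet B m (tail as)) ∧ bigMeet B n bs ∎

bigMeet-hom : {c₁ ℓ₁ c₂ ℓ₂ : Level} {A : BooleanAlgebra c₁ ℓ₁} {B : BooleanAlgebra c₂ ℓ₂}
              {φ : BooleanAlgebra.Carrier A → BooleanAlgebra.Carrier B} → IsBAHom A B φ →
              ∀ n (as : Fin n → BooleanAlgebra.Carrier A) →
              BooleanAlgebra._≈_ B (φ (bigMeet A n as)) (bigMeet B n (λ i → φ (as i)))
bigMeet-hom φ-hom zero    as = IsBAHom.hom-⊤ φ-hom
bigMeet-hom {B = B} φ-hom (suc n) as =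
  trans (IsBAHom.hom-∧ φ-hom _ _) (∧-congˡ (bigMeet-hom φ-hom n (λ i → as (suc i))))
  where open BooleanAlgebra B

module FilterProperties {c ℓ p : Level} {B : BooleanAlgebra c ℓ}
                        {S : BooleanAlgebra.Carrier B → Set p} (S-filter : IsFilter B S) where
  open BooleanAlgebra B
  open BooleanAlgebraOrder B
  open IsFilter S-filter

  upward : ∀ {x y} → x ≤ y → S x → S y
  upward x≤y = up-mem (≤⇒≤ᴮ x≤y)

  bigMeet-mem : ∀ n {as : Fin n → Carrier} → (∀ i → S (as i)) → S (bigMeet B n as)
  bigMeet-mem zero    mem = ⊤-mem
  bigMeet-mem (suc n) mem = ∧-mem (mem zero) (bigMeet-mem n (λ i → mem (suc i)))

  ∨-bigMeet-mem : ∀ n {a} {bs : Fin n → Carrier} → (∀ j → S (a ∨ bs j)) →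
                  S (a ∨ bigMeet B n bs)
  ∨-bigMeet-mem zero    mem = upward (y≤x∨y _ _) ⊤-mem
  ∨-bigMeet-mem (suc n) mem = upward (≤-reflexive (sym (∨-distribˡ-∧ _ _ _)))
    (∧-mem (mem zero) (∨-bigMeet-mem n (λ i → mem (suc i))))

  bigMeet-∨-bigMeet-mem : ∀ m n {as : Fin m → Carrier} {bs : Fin n → Carrier} →
                          (∀ i j → S (as i ∨ bs j)) → S (bigMeet B m as ∨ bigMeet B n bs)
  bigMeet-∨-bigMeet-mem zero    n mem = upward (x≤x∨y _ _) ⊤-mem
  bigMeet-∨-bigMeet-mem (suc m) n mem = upward (≤-reflexive (sym (∨-distribʳ-∧ _ _ _)))
    (∧-mem (∨-bigMeet-mem n (mem zero)) (bigMeet-∨-bigMeet-mem m n (λ i → mem (suc i))))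

module DoctrineProperties {o h c ℓ : Level} {C : Category o h} (Pr : FinProducts C)
                          (D : BooleanDoctrine C c ℓ) where
  open Category C
  open FinProducts Pr
  open BooleanDoctrine D
  open BooleanAlgebra using (Carrier)
  open module Fibre {X : Obj} = BooleanAlgebra (P₀ X) hiding (Carrier)
  open module FibreOrder {X : Obj} = BooleanAlgebraOrder (P₀ X)
  open module FibreMeets {X : Obj} = FiniteMeets (P₀ X)

  infix 4 _⊆_
  _⊆_ : {p q : Level} → Family Pr D p → Family Pr D q → Set (o ⊔ c ⊔ p ⊔ q)
  _⊆_ = _⊆ᶠ_ Pr D

  infixr 6 _∨×_
  _∨×_ : {X₁ X₂ : Obj} → Carrier (P₀ X₁) → Carrier (P₀ X₂) → Carrier (P₀ (X₁ ×ₒ X₂))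
  a ∨× b = P₁ pr₁ a ∨ P₁ pr₂ b

  _⊗_ : {X₁ X₂ Y₁ Y₂ : Obj} → Hom X₁ Y₁ → Hom X₂ Y₂ → Hom (X₁ ×ₒ X₂) (Y₁ ×ₒ Y₂)
  f ⊗ g = ⟨ f ∘ pr₁ , g ∘ pr₂ ⟩

  meetOfPullbacks : {n : ℕ} {X Y : Obj} → (Fin n → Hom X Y) → Carrier (P₀ Y) → Carrier (P₀ X)
  meetOfPullbacks {n} {X} fs a = bigMeet (P₀ X) n (λ i → P₁ (fs i) a)

  P₁-cong : {X Y : Obj} (f : Hom X Y) {a b : Carrier (P₀ Y)} → a ≈ b → P₁ f a ≈ P₁ f b
  P₁-cong f = IsBAHom.cong (P₁-hom f)

  P₁-mono : {X Y : Obj} (f : Hom X Y) {a b : Carrier (P₀ Y)} → a ≤ b → P₁ f a ≤ P₁ f b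
  P₁-mono f {a} {b} a≤b = trans (P₁-cong f a≤b) (IsBAHom.hom-∧ (P₁-hom f) a b)

  P₁-⟨,⟩-∨× : {X X₁ X₂ : Obj} (u : Hom X X₁) (v : Hom X X₂)
              (a : Carrier (P₀ X₁)) (b : Carrier (P₀ X₂)) →
              P₁ ⟨ u , v ⟩ (a ∨× b) ≈ P₁ u a ∨ P₁ v b
  P₁-⟨,⟩-∨× {X} u v a b = begin
    P₁ ⟨ u , v ⟩ (P₁ pr₁ a ∨ P₁ pr₂ b)
      ≈⟨ IsBAHom.hom-∨ (P₁-hom ⟨ u , v ⟩) _ _ ⟩
    P₁ ⟨ u , v ⟩ (P₁ pr₁ a) ∨ P₁ ⟨ u , v ⟩ (P₁ pr₂ b)
      ≈⟨ ∨-cong (P₁-∘ ⟨ u , v ⟩ pr₁ a) (P₁-∘ ⟨ u , v ⟩ pr₂ b) ⟨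
    P₁ (pr₁ ∘ ⟨ u , v ⟩) a ∨ P₁ (pr₂ ∘ ⟨ u , v ⟩) b
      ≡⟨ cong₂ (λ f g → P₁ f a ∨ P₁ g b) (pr₁-β u v) (pr₂-β u v) ⟩
    P₁ u a ∨ P₁ v b ∎
    where open SetoidReasoning (setoid {X})

  P₁-⊗-∨× : {X₁ X₂ Y₁ Y₂ : Obj} (f : Hom X₁ Y₁) (g : Hom X₂ Y₂)
            (a : Carrier (P₀ Y₁)) (b : Carrier (P₀ Y₂)) →
            P₁ (f ⊗ g) (a ∨× b) ≈ P₁ f a ∨× P₁ g b
  P₁-⊗-∨× f g a b =
    trans (P₁-⟨,⟩-∨× (f ∘ pr₁) (g ∘ pr₂) a b) (∨-cong (P₁-∘ pr₁ f a) (P₁-∘ pr₂ g b))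

  ∨×-monotonic : {X₁ X₂ : Obj} {a a′ : Carrier (P₀ X₁)} {b b′ : Carrier (P₀ X₂)} →
                 a ≤ a′ → b ≤ b′ → a ∨× b ≤ a′ ∨× b′
  ∨×-monotonic a≤a′ b≤b′ = ∨-monotonic (P₁-mono pr₁ a≤a′) (P₁-mono pr₂ b≤b′)

  P₁-meetOfPullbacks : {n : ℕ} {X Y Z : Obj} (g : Hom X Z) (fs : Fin n → Hom Z Y)
                       (a : Carrier (P₀ Y)) →
                       P₁ g (meetOfPullbacks fs a) ≈ meetOfPullbacks (λ i → fs i ∘ g) a
  P₁-meetOfPullbacks {n} g fs a =
    trans (bigMeet-hom (P₁-hom g) n _) (bigMeet-cong n (λ i → sym (P₁-∘ g (fs i) a)))

  meetOfPullbacks-++ : {m n : ℕ} {X Y : Obj} (fs : Fin m → Hom X Y) (gs : Fin n → Hom X Y)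
                       (a : Carrier (P₀ Y)) →
                       meetOfPullbacks (fs ++ gs) a ≈ meetOfPullbacks fs a ∧ meetOfPullbacks gs a
  meetOfPullbacks-++ {m} {n} fs gs a =
    trans (bigMeet-cong (m + n) (λ i → reflexive ([,]-∘ (λ f → P₁ f a) (splitAt m i))))
          (bigMeet-++ m _ _)

  Adjoin-⊆ : {p q : Level} {S : Family Pr D p} {G : Family Pr D q} {Y : Obj}
             {α : Carrier (P₀ Y)} → S ⊆ G → G Y α → Adjoin Pr D S Y α ⊆ G
  Adjoin-⊆ S⊆G _   X b (old b∈S) = S⊆G X b b∈S
  Adjoin-⊆ _   α∈G _ _ new       = α∈G

  record Extension {p : Level} (F : Family Pr D p) {Y : Obj} (α : Carrier (P₀ Y))
                   (X : Obj) (b : Carrier (P₀ X)) : Set (o ⊔ h ⊔ c ⊔ ℓ ⊔ p) where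
    constructor extension
    field
      {arity} : ℕ
      base    : Carrier (P₀ X)
      base∈F  : F X base
      maps    : Fin arity → Hom X Y
      bound   : base ∧ meetOfPullbacks maps α ≤ b

  module _ {p : Level} {F : Family Pr D p} (F-universal : IsUniversalFilter Pr D F) where
    open IsUniversalFilter F-universal

    extension-upward : {X Y : Obj} {α : Carrier (P₀ Y)} {b b′ : Carrier (P₀ X)} →
                       b ≤ b′ → Extension F α X b → Extension F α X b′
    extension-upward b≤b′ (extension β β∈F fs ≤b) = extension β β∈F fs (≤-trans ≤b b≤b′)

    extension-isUniversalFilter : {Y : Obj} (α : Carrier (P₀ Y)) →
                                  IsUniversalFilter Pr D (Extension F α)
    extension-isUniversalFilter α =
      record { stable = extension-stable ; filter = extension-filter }
      where
      extension-stable : {X Z : Obj} (g : Hom X Z) (a : Carrier (P₀ Z)) →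
                         Extension F α Z a → Extension F α X (P₁ g a)
      extension-stable g a (extension β β∈F fs β∧fs≤a) =
        extension (P₁ g β) (stable g β β∈F) (λ i → fs i ∘ g) (begin
          P₁ g β ∧ meetOfPullbacks (λ i → fs i ∘ g) α ≈⟨ ∧-congˡ (P₁-meetOfPullbacks g fs α) ⟨
          P₁ g β ∧ P₁ g (meetOfPullbacks fs α)        ≈⟨ IsBAHom.hom-∧ (P₁-hom g) _ _ ⟨
          P₁ g (β ∧ meetOfPullbacks fs α)             ≤⟨ P₁-mono g β∧fs≤a ⟩
          P₁ g a                                      ∎)
        where open ≤-Reasoning

      extension-filter : (X : Obj) → IsFilter (P₀ X) (Extension F α X)
      extension-filter X = record
        { ⊤-mem  = extension {arity = 0} ⊤ (IsFilter.⊤-mem (filter X)) (λ ()) (x∧y≤x _ _)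
        ; ∧-mem  = λ { (extension β₁ β₁∈F fs ≤b₁) (extension β₂ β₂∈F gs ≤b₂) →
            extension (β₁ ∧ β₂) (IsFilter.∧-mem (filter X) β₁∈F β₂∈F) (fs ++ gs)
              (≤-trans (≤-reflexive (∧-congˡ (meetOfPullbacks-++ fs gs α)))
                (∧-greatest (≤-trans (∧-monotonic (x∧y≤x _ _) (x∧y≤x _ _)) ≤b₁)
                            (≤-trans (∧-monotonic (x∧y≤y _ _) (x∧y≤y _ _)) ≤b₂))) }
        ; up-mem = λ b≤b′ → extension-upward (≤ᴮ⇒≤ b≤b′)
        }

    module _ {Y : Obj} (α : Carrier (P₀ Y)) where

      F⊆extension : F ⊆ Extension F α
      F⊆extension X β β∈F = extension {arity = 0} β β∈F (λ ()) (x∧y≤x _ _)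

      meetOfPullbacks∈extension : {n : ℕ} {X : Obj} (fs : Fin n → Hom X Y) →
                                  Extension F α X (meetOfPullbacks fs α)
      meetOfPullbacks∈extension fs = extension ⊤ (IsFilter.⊤-mem (filter _)) fs (x∧y≤y _ _)

      pullback∈extension : {X : Obj} (f : Hom X Y) → Extension F α X (P₁ f α)
      pullback∈extension f = extension {arity = 1} ⊤ (IsFilter.⊤-mem (filter _)) (λ _ → f)
        (≤-trans (x∧y≤y _ _) (x∧y≤x _ _))

      α∈extension : Extension F α Y α
      α∈extension = extension-upward (≤-reflexive (P₁-id α)) (pullback∈extension id)

      extension-least : {q : Level} {G : Family Pr D q} → IsUniversalFilter Pr D G →
                        F ⊆ G → G Y α → Extension F α ⊆ G
      extension-least G-universal F⊆G α∈G X _ (extension {n} β β∈F fs ≤b) =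
        upward ≤b (∧-mem (F⊆G X β β∈F)
          (bigMeet-mem n (λ i → IsUniversalFilter.stable G-universal (fs i) α α∈G)))
        where
        open IsFilter (IsUniversalFilter.filter G-universal X)
        open FilterProperties (IsUniversalFilter.filter G-universal X)

      genFilter⊆extension :
        GenFilter Pr D (o ⊔ h ⊔ c ⊔ ℓ ⊔ p) (Adjoin Pr D F Y α) ⊆ Extension F α
      genFilter⊆extension _ _ b∈gen = b∈gen (Extension F α) (extension-isUniversalFilter α)
        (Adjoin-⊆ F⊆extension α∈extension)

      extension⊆genFilter : {q : Level} → Extension F α ⊆ GenFilter Pr D q (Adjoin Pr D F Y α)
      extension⊆genFilter X b b∈ext G G-universal adjoin⊆G =
        extension-least G-universal (λ X β β∈F → adjoin⊆G X β (old β∈F)) (adjoin⊆G Y α new)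
          X b b∈ext

    extension-trans : {X Y : Obj} {a : Carrier (P₀ Y)} {b : Carrier (P₀ X)} →
                      Extension F a X b → Extension F b ⊆ Extension F a
    extension-trans {a = a} {b} b∈ext =
      extension-least b (extension-isUniversalFilter a) (F⊆extension a) b∈ext

    extension-by-member⊆F : {X : Obj} {b : Carrier (P₀ X)} → F X b → Extension F b ⊆ F
    extension-by-member⊆F {b = b} b∈F = extension-least b F-universal (λ _ _ β∈F → β∈F) b∈F

    extension-∨× : {V₁ V₂ X₁ X₂ : Obj} {a₁ : Carrier (P₀ X₁)} {a₂ : Carrier (P₀ X₂)}
                   {u₁ : Carrier (P₀ V₁)} {u₂ : Carrier (P₀ V₂)} →
                   Extension F a₁ V₁ u₁ → Extension F a₂ V₂ u₂ →
                   Extension F (a₁ ∨× a₂) (V₁ ×ₒ V₂) (u₁ ∨× u₂)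
    extension-∨× {V₁} {V₂} {a₁ = a₁} {a₂} {u₁} {u₂}
                 (extension {m} β₁ β₁∈F fs ≤u₁) (extension {n} β₂ β₂∈F gs ≤u₂) =
      upward (begin
        bigMeet (P₀ _) (suc m) (λ i → P₁ pr₁ (xs i)) ∨ bigMeet (P₀ _) (suc n) (λ j → P₁ pr₂ (ys j))
          ≈⟨ ∨-cong (bigMeet-hom (P₁-hom pr₁) (suc m) xs) (bigMeet-hom (P₁-hom pr₂) (suc n) ys) ⟨
        bigMeet (P₀ V₁) (suc m) xs ∨× bigMeet (P₀ V₂) (suc n) ys
          ≤⟨ ∨×-monotonic ≤u₁ ≤u₂ ⟩
        u₁ ∨× u₂ ∎)
        (bigMeet-∨-bigMeet-mem (suc m) (suc n) pair∈extension)
      where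
      open ≤-Reasoning
      open FilterProperties
        (IsUniversalFilter.filter (extension-isUniversalFilter (a₁ ∨× a₂)) (V₁ ×ₒ V₂))

      xs : Fin (suc m) → Carrier (P₀ V₁)
      xs = β₁ ∷ λ i → P₁ (fs i) a₁

      ys : Fin (suc n) → Carrier (P₀ V₂)
      ys = β₂ ∷ λ j → P₁ (gs j) a₂

      pair∈extension : ∀ i j → Extension F (a₁ ∨× a₂) (V₁ ×ₒ V₂) (P₁ pr₁ (xs i) ∨ P₁ pr₂ (ys j))
      pair∈extension zero    j       =
        upward (x≤x∨y _ _) (F⊆extension (a₁ ∨× a₂) _ _ (stable pr₁ β₁ β₁∈F))
      pair∈extension (suc i) zero    =
        upward (y≤x∨y _ _) (F⊆extension (a₁ ∨× a₂) _ _ (stable pr₂ β₂ β₂∈F))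
      pair∈extension (suc i) (suc j) =
        upward (≤-reflexive (P₁-⊗-∨× (fs i) (gs j) a₁ a₂))
          (pullback∈extension (a₁ ∨× a₂) (fs i ⊗ gs j))

  JoinIdeal : {p : Level} (F I : Family Pr D p) {Y : Obj} (α : Carrier (P₀ Y)) →
              Family Pr D (o ⊔ h ⊔ c ⊔ ℓ ⊔ p)
  JoinIdeal F I {Y} α X b =
    Σ Obj λ Z → Σ (Carrier (P₀ Z)) λ γ → I Z γ × Extension F b (Y ×ₒ Z) (α ∨× γ)

  module _ {p : Level} {F I : Family Pr D p} (F-universal : IsUniversalFilter Pr D F)
           (I-universal : IsUniversalIdeal Pr D I) {Y : Obj} (α : Carrier (P₀ Y)) where
    open IsUniversalIdeal I-universal

    joinIdeal-isUniversalIdeal : IsUniversalIdeal Pr D (JoinIdeal F I α)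
    joinIdeal-isUniversalIdeal = record
      { reflect = λ { _ fs a (Z , γ , γ∈I , e) →
          Z , γ , γ∈I ,
          extension-trans F-universal (meetOfPullbacks∈extension F-universal a fs) _ _ e }
      ; down = λ { _ b≤b′ (Z , γ , γ∈I , e) →
          Z , γ , γ∈I ,
          extension-trans F-universal
            (extension-upward F-universal (≤ᴮ⇒≤ b≤b′) (α∈extension F-universal _)) _ _ e }
      ; prod = joinIdeal-prod
      ; bot = t , ⊥ , bot ,
          extension-upward F-universal (≤-trans (≤-reflexive (IsBAHom.hom-⊥ (P₁-hom !))) ⊥≤x)
            (pullback∈extension F-universal ⊥ !)
      }
      where
      joinIdeal-prod : {X₁ X₂ : Obj} (a₁ : Carrier (P₀ X₁)) (a₂ : Carrier (P₀ X₂)) →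
                       JoinIdeal F I α X₁ a₁ → JoinIdeal F I α X₂ a₂ →
                       JoinIdeal F I α (X₁ ×ₒ X₂) (a₁ ∨× a₂)
      joinIdeal-prod a₁ a₂ (Z₁ , γ₁ , γ₁∈I , e₁) (Z₂ , γ₂ , γ₂∈I , e₂) =
        Z₁ ×ₒ Z₂ , γ₁ ∨× γ₂ , prod γ₁ γ₂ γ₁∈I γ₂∈I ,
        extension-upward F-universal regroup
          (IsUniversalFilter.stable (extension-isUniversalFilter F-universal (a₁ ∨× a₂))
            ⟨ id ⊗ pr₁ , id ⊗ pr₂ ⟩ _ (extension-∨× F-universal e₁ e₂))
        where
        open ≤-Reasoning
        -- ⟨ id ⊗ pr₁ , id ⊗ pr₂ ⟩ : Y × (Z₁ × Z₂) → (Y × Z₁) × (Y × Z₂) shares the Y-component.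
        regroup : P₁ ⟨ id ⊗ pr₁ , id ⊗ pr₂ ⟩ ((α ∨× γ₁) ∨× (α ∨× γ₂)) ≤ α ∨× (γ₁ ∨× γ₂)
        regroup = begin
          P₁ ⟨ id ⊗ pr₁ , id ⊗ pr₂ ⟩ ((α ∨× γ₁) ∨× (α ∨× γ₂))
            ≈⟨ P₁-⟨,⟩-∨× _ _ _ _ ⟩
          P₁ (id ⊗ pr₁) (α ∨× γ₁) ∨ P₁ (id ⊗ pr₂) (α ∨× γ₂)
            ≈⟨ ∨-cong (P₁-⊗-∨× id pr₁ α γ₁) (P₁-⊗-∨× id pr₂ α γ₂) ⟩
          (P₁ id α ∨× P₁ pr₁ γ₁) ∨ (P₁ id α ∨× P₁ pr₂ γ₂)
            ≤⟨ ∨-least (∨×-monotonic (≤-reflexive (P₁-id α)) (x≤x∨y _ _))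
                       (∨×-monotonic (≤-reflexive (P₁-id α)) (y≤x∨y _ _)) ⟩
          α ∨× (γ₁ ∨× γ₂) ∎

    I⊆joinIdeal : I ⊆ JoinIdeal F I α
    I⊆joinIdeal X b b∈I =
      X , b , b∈I , extension-upward F-universal (y≤x∨y _ _) (pullback∈extension F-universal b pr₂)

    α∈joinIdeal : JoinIdeal F I α Y α
    α∈joinIdeal =
      t , ⊥ , bot , extension-upward F-universal (x≤x∨y _ _) (pullback∈extension F-universal α pr₁)

    genIdeal⊆joinIdeal :
      GenIdeal Pr D (o ⊔ h ⊔ c ⊔ ℓ ⊔ p) (Adjoin Pr D I Y α) ⊆ JoinIdeal F I α
    genIdeal⊆joinIdeal _ _ b∈gen =
      b∈gen (JoinIdeal F I α) joinIdeal-isUniversalIdeal (Adjoin-⊆ I⊆joinIdeal α∈joinIdeal)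

lemma3p17 : {o h c ℓ p : Level} (C : Category o h) (Pr : FinProducts C)
    (D : BooleanDoctrine C c ℓ)
    (F : Family Pr D p) → IsUniversalFilter Pr D F →
    (I : Family Pr D p) → IsUniversalIdeal Pr D I →
    (Y : Category.Obj C) (α : BooleanAlgebra.Carrier (BooleanDoctrine.P₀ D Y)) →
    (Meets Pr D (GenFilter Pr D (o ⊔ h ⊔ c ⊔ ℓ ⊔ p) (Adjoin Pr D F Y α)) I
      ⇔ Σ (Category.Obj C) λ X → Σ ℕ λ n → Σ (Fin n → Category.Hom C X Y) λ f →
          Σ (BooleanAlgebra.Carrier (BooleanDoctrine.P₀ D X)) λ β → F X β ×
          I X (BooleanAlgebra._∧_ (BooleanDoctrine.P₀ D X) β
                 (bigMeet (BooleanDoctrine.P₀ D X) n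
                   (λ i → BooleanDoctrine.P₁ D (f i) α))))
    ×
    (Meets Pr D (GenIdeal Pr D (o ⊔ h ⊔ c ⊔ ℓ ⊔ p) (Adjoin Pr D I Y α)) F
      ⇔ (Meets Pr D I F
         Data.Sum.⊎
         (Σ (Category.Obj C) λ Z →
            Σ (BooleanAlgebra.Carrier (BooleanDoctrine.P₀ D Z)) λ γ → I Z γ ×
            F (FinProducts._×ₒ_ Pr Y Z)
              (BooleanAlgebra._∨_ (BooleanDoctrine.P₀ D (FinProducts._×ₒ_ Pr Y Z))
                 (BooleanDoctrine.P₁ D (FinProducts.pr₁ Pr {Y} {Z}) α)
                 (BooleanDoctrine.P₁ D (FinProducts.pr₂ Pr {Y} {Z}) γ)))))
lemma3p17 C Pr D F F-universal I I-universal Y α =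
  mk⇔ (λ { (X , b , b∈gen , b∈I) →
          let open Extension (genFilter⊆extension F-universal α X b b∈gen)
          in X , arity , maps , base , base∈F ,
             IsUniversalIdeal.down I-universal X (≤⇒≤ᴮ bound) b∈I })
      (λ { (X , n , fs , β , β∈F , β∧fs∈I) →
          X , _ , extension⊆genFilter F-universal α X _ (extension β β∈F fs ≤-refl) , β∧fs∈I })
  ,
  mk⇔ (λ { (X , b , b∈gen , b∈F) →
          let (Z , γ , γ∈I , α∨γ∈ext) = genIdeal⊆joinIdeal F-universal I-universal α X b b∈gen
          in Data.Sum.inj₂ (Z , γ , γ∈I , extension-by-member⊆F F-universal b∈F _ _ α∨γ∈ext) })
      (λ { (Data.Sum.inj₁ (X , b , b∈I , b∈F)) →
             X , b , (λ G _ adjoin⊆G → adjoin⊆G X b (old b∈I)) , b∈F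
         ; (Data.Sum.inj₂ (Z , γ , γ∈I , α∨γ∈F)) →
             Y ×ₒ Z , _ ,
             (λ G G-ideal adjoin⊆G →
                IsUniversalIdeal.prod G-ideal α γ (adjoin⊆G Y α new) (adjoin⊆G Z γ (old γ∈I))) ,
             α∨γ∈F })
  where
  open FinProducts Pr using (_×ₒ_)
  open DoctrineProperties Pr D
  open FibreOrder using (≤-refl; ≤⇒≤ᴮ)
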